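{- The adjunction $F\dashv G$ between $\mathsf{DRA}$ and $\mathsf{HEt}^{\mathrm{op}}$ restricts and co-restricts to an adjunction between the category $\mathsf{SubtrAlg}$ of subtraction algebras and the opposite of the category $\mathsf{Haus_p}$ of Hausdorff spaces with continuous proper partial functions. More precisely: if $A$ is a subtraction algebra (regarded as a difference–restriction algebra with $\rhd:=\cdot$), then $F(A)$ is an identity map (so lies in $\mathsf{Haus_p}$), and if $X$ is a Hausdorff space then $G(\mathrm{id}_X)$ is a subtraction algebra (i.e.\ its $\rhd$ coincides with its $\cdot$).
   Context: A subtraction algebra is an algebra $(A,-)$ with one binary operation satisfying $a-(b-a)=a$, $a\cdot b=b\cdot a$ where $a\cdot b:=a-(a-b)$, and $(a-b)-c=(a-c)-b$; $\mathsf{SubtrAlg}$ has $\{ -\}$-homomorphisms as morphisms. A subtraction algebra with $\rhd:=\cdot$ is a difference–restriction algebra, i.e. an algebra $(A,-,\rhd)$ isomorphic to an algebra of partial functions under relative complement $f-g=f\setminus g$ and domain restriction $f\rhd g=\{(x,y)\in g:x\in\mathrm{dom}(f)\}$; this identifies $\mathsf{SubtrAlg}$ with a full subcategory of the category $\mathsf{DRA}$ of difference–restriction algebras. The order is $a\le b$ iff $a\cdot b=a$. An étale space is a surjective local homeomorphism $\pi\colon X\to X_0$. $\mathsf{HEt}$: objects étale spaces with $X$ Hausdorff; morphisms from $\pi\colon X\to X_0$ to $\rho\colon Y\to Y_0$ are partial functions $\varphi\colon X\rightharpoonup Y$ with preimages of open sets open and of compact sets compact, satisfying (Q1) $\varphi(x),\varphi(x')$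 defined and $\pi(x)=\pi(x')$ imply $\rho\varphi(x)=\rho\varphi(x')$; (Q2) $\varphi(x),\varphi(x')$ defined, $\pi(x)=\pi(x')$, $\varphi(x)=\varphi(x')$ imply $x=x'$; (Q3) if $\varphi(x)$ is defined and $\rho(y)=\rho(\varphi(x))$ then $y=\varphi(x')$ for some $x'$ with $\pi(x')=\pi(x)$. $\mathsf{Haus_p}$ is identified with the full subcategory of $\mathsf{HEt}$ whose objects are identity maps $\mathrm{id}_X\colon X\to X$. $F\colon\mathsf{DRA}\to\mathsf{HEt}^{\mathrm{op}}$: $\mathrm{Pf}(A)$ is the set of maximal proper filters (nonempty, upward closed, $\cdot$-closed subsets) of $(A,\le)$ with the topology generated by $\widehat a=\{\mu:a\in\mu\}$; $\mu\approx_A\nu$ iff $a\rhd b\in\nu$ for all $a\in\mu,b\in\nu$; $F(A)$ is the quotient map $\mathrm{Pf}(A)\to\mathrm{Pf}(A)/{\approx_A}$; for $h\colon A\to B$, $F(h)\colon\mathrm{Pf}(B)\rightharpoonup\mathrm{Pf}(A)$ sends $\xi$ to $h^{ -1}(\xi)$ when nonempty. $G\colon\mathsf{HEt}^{\mathrm{op}}\to\mathsf{DRA}$: $G(\pi)$ is the set of compact open $U\subseteq X$ with $\pi|_U$ injective, with $U-V$ set difference and $U\rhd V=\pi^{ -1}(\pi(U))\cap V$; $G(\varphi)(U)=\varphi^{ -1}(U)$. $F\dashv G$ is an adjunction. -}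

module Defs where

open import Data.Product using (Σ; ∃; _×_; _,_)
open import Data.Sum using (_⊎_)
open import Data.Empty using (⊥)
open import Data.Unit using (⊤)
open import Data.List using (List)
open import Data.List.Membership.Propositional using (_∈_)
open import Relation.Nullary using (¬_)
open import Relation.Binary.PropositionalEquality using (_≡_)
open import Level using (Level; suc; zero)

Subset : Set → Set₁
Subset X = X → Set

_⊆_ : {X : Set} → Subset X → Subset X → Set
U ⊆ V = ∀ x → U x → V x

_≐_ : {X : Set} → Subset X → Subset X → Set
U ≐ V = (U ⊆ V) × (V ⊆ U)

-- classical metatheory (the paper works classically)
ExcludedMiddle : Set₁
ExcludedMiddle = (P : Set) → P ⊎ ¬ P

record SubtractionAlgebra : Set₁ where
  infixl 6 _-_
  field
    Carrier : Set
    _-_     : Carrier → Carrier → Carrier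
  _·_ : Carrier → Carrier → Carrier
  a · b = a - (a - b)
  field
    absorb : ∀ a b → a - (b - a) ≡ a
    ·-comm : ∀ a b → a · b ≡ b · a
    exch   : ∀ a b c → (a - b) - c ≡ (a - c) - b
  _▷_ : Carrier → Carrier → Carrier
  a ▷ b = a · b
  _≤_ : Carrier → Carrier → Set
  a ≤ b = a · b ≡ a

module _ (A : SubtractionAlgebra) where
  open SubtractionAlgebra A

  record IsProperFilter (μ : Subset Carrier) : Set where
    field
      nonempty : ∃ λ a → μ a
      upClosed : ∀ a b → μ a → a ≤ b → μ b
      ·-closed : ∀ a b → μ a → μ b → μ (a · b)
      proper   : ∃ λ a → ¬ μ a

  record IsMaxProperFilter (μ : Subset Carrier) : Set₁ where
    field
      isProperFilter : IsProperFilter μ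
      maximal        : ∀ ν → IsProperFilter ν → μ ⊆ ν → ν ⊆ μ

  _≈A_ : Subset Carrier → Subset Carrier → Set
  μ ≈A ν = ∀ a b → μ a → ν b → ν (a ▷ b)

  -- F(A) : Pf(A) → Pf(A)/≈_A is an identity map: ≈_A is equality on Pf(A)
  FIsIdentity : Set₁
  FIsIdentity = ∀ μ ν → IsMaxProperFilter μ → IsMaxProperFilter ν →
                μ ≈A ν → μ ≐ ν

record TopSpace : Set₁ where
  field
    Carrier : Set
    Open    : Subset Carrier → Set
    open-whole : Open (λ _ → ⊤)
    open-∩     : ∀ U V → Open U → Open V → Open (λ x → U x × V x)
    open-⋃     : (I : Set) (U : I → Subset Carrier) → (∀ i → Open (U i)) →
                 Open (λ x → ∃ λ i → U i x)
    open-ext   : ∀ U V → U ≐ V → Open U → Open V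

module _ (X : TopSpace) where
  open TopSpace X

  IsHausdorff : Set₁
  IsHausdorff = ∀ x y → ¬ (x ≡ y) →
    Σ (Subset Carrier) λ U → Σ (Subset Carrier) λ V →
      Open U × Open V × U x × V y × (∀ z → U z → V z → ⊥)

  IsCompact : Subset Carrier → Set₁
  IsCompact K = (I : Set) (W : I → Subset Carrier) → (∀ i → Open (W i)) →
    (K ⊆ λ x → ∃ λ i → W i x) →
    Σ (List I) λ is → K ⊆ λ x → ∃ λ i → i ∈ is × W i x

  πid : Carrier → Carrier
  πid x = x

  IsGElem : Subset Carrier → Set₁
  IsGElem U = IsCompact U × Open U ×
              (∀ x y → U x → U y → πid x ≡ πid y → x ≡ y)

  _-G_ : Subset Carrier → Subset Carrier → Subset Carrier
  (U -G V) x = U x × ¬ V x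

  _▷G_ : Subset Carrier → Subset Carrier → Subset Carrier
  (U ▷G V) x = (∃ λ y → U y × πid y ≡ πid x) × V x

  _·G_ : Subset Carrier → Subset Carrier → Subset Carrier
  U ·G V = U -G (U -G V)

  GIsSubtraction : Set₁
  GIsSubtraction = ∀ U V → IsGElem U → IsGElem V → (U ▷G V) ≐ (U ·G V)

-- In a subtraction algebra a · b ≤ a, so if μ ≈ ν then for a ∈ μ and any b ∈ ν the
-- element a · b = a ▷ b lies in ν below a, forcing a ∈ ν; thus μ ⊆ ν and maximality
-- of μ gives μ = ν. In G(id_X) the projection is the identity, so for arbitrary
-- subsets U ▷ V = U ∩ V, which is U · V = U ∖ (U ∖ V) once membership in V is classically stable.
module Submission where

open import Defs
open import Data.Product using (_×_; _,_)
open import Data.Sum using ([_,_])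
open import Data.Empty using (⊥-elim)
open import Function using (id)
open import Relation.Binary.PropositionalEquality using (_≡_; refl; sym; cong)
open import Relation.Unary using (Stable)
open Relation.Binary.PropositionalEquality.≡-Reasoning

module SubtractionAlgebraProperties (A : SubtractionAlgebra) where
  open SubtractionAlgebra A

  [x-x]-x≡x-x : ∀ x → (x - x) - x ≡ x - x
  [x-x]-x≡x-x x = begin
    (x - x) - x             ≡⟨ cong ((x - x) -_) (sym (absorb x x)) ⟩
    (x - x) - (x - (x - x)) ≡⟨ absorb (x - x) x ⟩
    x - x                   ∎

  [x-x]·y≡x-x : ∀ x y → (x - x) · y ≡ x - x
  [x-x]·y≡x-x x y = begin
    (x - x) - ((x - x) - y) ≡⟨ cong ((x - x) -_) (exch x x y) ⟩
    (x - x) - ((x - y) - x) ≡⟨ exch x x ((x - y) - x) ⟩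
    (x - ((x - y) - x)) - x ≡⟨ cong (_- x) (absorb x (x - y)) ⟩
    x - x                   ∎

  x-x≡y-y : ∀ x y → x - x ≡ y - y
  x-x≡y-y x y = begin
    x - x             ≡⟨ sym ([x-x]·y≡x-x x (y - y)) ⟩
    (x - x) · (y - y) ≡⟨ ·-comm (x - x) (y - y) ⟩
    (y - y) · (x - x) ≡⟨ [x-x]·y≡x-x y (x - x) ⟩
    y - y             ∎

  x-[y-y]≡x : ∀ x y → x - (y - y) ≡ x
  x-[y-y]≡x x y = begin
    x - (y - y) ≡⟨ cong (x -_) (x-x≡y-y y x) ⟩
    x - (x - x) ≡⟨ absorb x x ⟩
    x           ∎

  [x-x]-y≡x-x : ∀ x y → (x - x) - y ≡ x - x
  [x-x]-y≡x-x x y = begin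
    (x - x) - y ≡⟨ cong (_- y) (x-x≡y-y x y) ⟩
    (y - y) - y ≡⟨ [x-x]-x≡x-x y ⟩
    y - y       ≡⟨ x-x≡y-y y x ⟩
    x - x       ∎

  x·[x-y]≡x-y : ∀ x y → x · (x - y) ≡ x - y
  x·[x-y]≡x-y x y = begin
    x · (x - y)             ≡⟨ ·-comm x (x - y) ⟩
    (x - y) - ((x - y) - x) ≡⟨ cong ((x - y) -_) (exch x y x) ⟩
    (x - y) - ((x - x) - y) ≡⟨ cong ((x - y) -_) ([x-x]-y≡x-x x y) ⟩
    (x - y) - (x - x)       ≡⟨ x-[y-y]≡x (x - y) x ⟩
    x - y                   ∎

  x·y≤x : ∀ x y → (x · y) ≤ x
  x·y≤x x y = begin
    (x · y) · x       ≡⟨ ·-comm (x · y) x ⟩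
    x · (x - (x - y)) ≡⟨ cong (x -_) (x·[x-y]≡x-y x y) ⟩
    x · y             ∎

  ≈A⇒⊆ : ∀ μ ν → IsProperFilter A ν → _≈A_ A μ ν → μ ⊆ ν
  ≈A⇒⊆ μ ν ν-filter μ≈ν a μa =
    let b , νb = nonempty in upClosed (a · b) a (μ≈ν a b μa νb) (x·y≤x a b)
    where open IsProperFilter ν-filter

  fIsIdentity : FIsIdentity A
  fIsIdentity μ ν μ-max ν-max μ≈ν = μ⊆ν , maximal ν ν-filter μ⊆ν
    where
    open IsMaxProperFilter μ-max using (maximal)
    ν-filter : IsProperFilter A ν
    ν-filter = IsMaxProperFilter.isProperFilter ν-max
    μ⊆ν : μ ⊆ ν
    μ⊆ν = ≈A⇒⊆ μ ν ν-filter μ≈ν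

excludedMiddle⇒stable : ExcludedMiddle → {X : Set} (V : Subset X) → Stable V
excludedMiddle⇒stable em V x ¬¬Vx = [ id , (λ ¬Vx → ⊥-elim (¬¬Vx ¬Vx)) ] (em (V x))

▷G≐·G : (X : TopSpace) (U V : Subset (TopSpace.Carrier X)) →
        Stable V → _≐_ (_▷G_ X U V) (_·G_ X U V)
▷G≐·G X U V V-stable = ▷⊆· , ·⊆▷
  where
  ▷⊆· : _⊆_ (_▷G_ X U V) (_·G_ X U V)
  ▷⊆· x ((.x , Ux , refl) , Vx) = Ux , λ (_ , ¬Vx) → ¬Vx Vx

  ·⊆▷ : _⊆_ (_·G_ X U V) (_▷G_ X U V)
  ·⊆▷ x (Ux , ¬[Ux×¬Vx]) = (x , Ux , refl) , V-stable x (λ ¬Vx → ¬[Ux×¬Vx] (Ux , ¬Vx))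

proposition6p1 : ExcludedMiddle →
    ((A : SubtractionAlgebra) → FIsIdentity A) ×
    ((X : TopSpace) → IsHausdorff X → GIsSubtraction X)
proposition6p1 em =
    SubtractionAlgebraProperties.fIsIdentity
  , λ X _ U V _ _ → ▷G≐·G X U V (excludedMiddle⇒stable em V)
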